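{- Any streaming certification scheme for $\mathrm{Coloring}_{\leq}$ whose verifier uses $m$ bits of memory and whose certificates have $c$ bits satisfies $c+m=\Omega(n\log n)$ on $n$-node graphs.
   Context: $\mathrm{Coloring}_{\leq}$ takes as input a graph $G$ and a threshold $k$ and asks whether the chromatic number of $G$ is at most $k$. Inputs: an $n$-node graph on $[n]$ and threshold $k$; $k$ is given first, then the edges arrive as a stream in an arbitrary, possibly adversarial, order. A streaming certification scheme for a decision problem $P$ consists of a prover (a computationally unlimited function producing a certificate in $\{0,1\}^*$ depending only on the input, not on the edge order) and a verifier (a deterministic streaming algorithm with read-only access to the certificate that processes the stream and outputs accept or reject). Completeness: if the input satisfies $P$, some certificate makes the verifier accept for every edge order. Soundness: if the input does not satisfy $P$, the verifier rejects for every certificate and every edge order. $c$ is the certificate length and $m$ the verifier's memory excluding the certificate, as worst-case functions of $n$. -}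

module Defs where

open import Data.Nat using (ℕ; _<_; _≤_)
open import Data.Fin using (Fin; toℕ)
open import Data.Bool using (Bool; true; false)
open import Data.List using (List; length; foldl)
open import Data.List.Relation.Unary.All using (All)
open import Data.List.Relation.Unary.Unique.Propositional using (Unique)
open import Data.List.Membership.Propositional using (_∈_)
open import Data.Vec using (Vec)
open import Data.Product using (Σ; ∃; _×_; _,_; proj₁; proj₂)
open import Relation.Binary.PropositionalEquality using (_≡_; _≢_)
open import Relation.Nullary using (¬_)

-- A vertex pair {u,v} of [n] is encoded canonically as (u , v) with u < v.
Pair : ℕ → Set
Pair n = Fin n × Fin n

Canonical : ∀ {n} → Pair n → Set
Canonical (u , v) = toℕ u < toℕ v

-- A simple graph on [n]: its edge-indicator on canonical pairs
-- (only values at pairs u < v are ever consulted).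
Graph : ℕ → Set
Graph n = Fin n → Fin n → Bool

IsEdge : ∀ {n} → Graph n → Fin n → Fin n → Set
IsEdge E u v = toℕ u < toℕ v × E u v ≡ true

ChromaticAtMost : ∀ {n} → ℕ → Graph n → Set
ChromaticAtMost {n} k E =
  Σ (Fin n → Fin k) λ f → ∀ u v → IsEdge E u v → f u ≢ f v

IsStream : ∀ {n} → Graph n → List (Pair n) → Set
IsStream {n} E s =
  Unique s × All Canonical s ×
  (∀ (u v : Fin n) → toℕ u < toℕ v → ((u , v) ∈ s → E u v ≡ true) × (E u v ≡ true → (u , v) ∈ s))

Cert : ℕ → Set
Cert c = Σ (List Bool) λ l → length l ≤ c

State : ℕ → Set
State m = Vec Bool m

-- The threshold k arrives first (initial state), then the edges one by one.
record Verifier (n c m : ℕ) : Set where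
  field
    init   : ℕ → Cert c → State m
    step   : Cert c → State m → Pair n → State m
    accept : Cert c → State m → Bool

run : ∀ {n c m} → Verifier n c m → ℕ → Cert c → List (Pair n) → Bool
run V k w s = Verifier.accept V w (foldl (Verifier.step V w) (Verifier.init V k w) s)

CertifiesColoring : ∀ {n c m} → Verifier n c m → Set
CertifiesColoring {n} {c} V =
  ∀ (k : ℕ) (E : Graph n) →
    (ChromaticAtMost k E →
       Σ (Cert c) λ w → ∀ s → IsStream E s → run V k w s ≡ true)
  × (¬ ChromaticAtMost k E →
       ∀ (w : Cert c) s → IsStream E s → run V k w s ≡ false)

-- Take k = 2^s colours and, for f, g : [t] → [k], the graph on
-- vertices anchor₁ i, anchor₂ i (i < k) and var j (j < t) in which two vertices are
-- adjacent iff their labels differ: anchors are labelled by their index and var j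
-- by f j, except on the pairs {anchor₂ i, var j}, where var j is labelled g j. These
-- pairs are streamed last, so the first half of the stream depends only on f and
-- the second only on g. The labelling colours the graph when f = g, while if
-- f j ≠ g j then var j, anchor₂ (f j) and the anchor₁ l with l ≠ f j form a
-- (k+1)-clique. If two f ≠ g led the verifier to the same certificate and memory
-- after the first half of the accepted run on (f, f), it would also accept (f, g).
-- Hence k^t = 2^(st) is at most the 2^(c+m+2) possible certificate/memory pairs,
-- and s ≈ log n, t ≈ n/2 gives c + m = Ω(n log n).
module Submission where

open import Defs
open import Data.Nat using (ℕ; zero; suc; _+_; _*_; _^_; _∸_; _≤_; _<_; z≤n; s≤s; _<?_; ⌊_/2⌋; ⌈_/2⌉)
open import Data.Nat.Properties
  using ( suc-injective; *-cancelˡ-≡; even≢odd; ≤-trans; ≤-refl; ≤-reflexive; ≤-irrelevant; <-cmp; <-irrefl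
        ; n≤1+n; <⇒≱; ≮⇒≥; +-monoˡ-≤; +-monoʳ-≤; +-mono-≤; *-monoʳ-≤; *-mono-≤; +-cancelˡ-≤; +-suc
        ; m≤m+n; m+[n∸m]≡n; ∸-monoˡ-≤; ^-monoʳ-≤; ^-monoʳ-<; ^-distribˡ-+-*; ^-*-assoc; m^n>0
        ; +-identityʳ; ⌊n/2⌋≤⌈n/2⌉; ⌊n/2⌋+⌈n/2⌉≡n; module ≤-Reasoning )
open import Data.Nat.Logarithm using (⌊log₂_⌋; ⌊log₂⌋-mono-≤; ⌊log₂⌊n/2⌋⌋≡⌊log₂n⌋∸1; ⌊log₂[2^n]⌋≡n)
open import Data.Nat.Tactic.RingSolver using (solve-∀)
open import Data.Fin as Fin using (Fin; toℕ; fromℕ<; combine; splitAt; _↑ˡ_; _↑ʳ_; funToFin; finToFun)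
open import Data.Fin.Properties
  using (toℕ-fromℕ<; toℕ-injective; combine-injective; injective⇒≤; splitAt-↑ˡ; splitAt-↑ʳ; funToFin-finToFin)
open import Data.Bool using (Bool; true; false; not; _∧_; _∨_)
open import Data.Bool.Properties using (∨-identityʳ; ∨-zeroʳ)
import Data.Bool.Properties as Bool
open import Data.List using (List; []; _∷_; length; foldl; filter; cartesianProduct; allFin; _++_)
open import Data.List.Properties using (foldl-++)
open import Data.List.Relation.Unary.All as All using ()
import Data.List.Relation.Unary.All.Properties as All
import Data.List.Relation.Unary.Unique.Propositional.Properties as Unique
open import Data.List.Membership.Propositional using (_∈_)
open import Data.List.Membership.Propositional.Properties
  using (∈-filter⁻; ∈-filter⁺; ∈-cartesianProduct⁺; ∈-allFin; ∈-++⁻; ∈-++⁺ˡ; ∈-++⁺ʳ)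
open import Data.Vec using (toList)
open import Data.Vec.Properties using (toList-injective; length-toList; cast-is-id)
open import Data.Product using (Σ; _×_; _,_; proj₁; proj₂)
open import Data.Sum using ([_,_]′)
open import Data.Empty using (⊥; ⊥-elim)
open import Function using (_∘_; Injective)
open import Relation.Binary using (tri<; tri≈; tri>)
open import Relation.Unary using (Decidable)
open import Relation.Binary.PropositionalEquality
  using (_≡_; _≢_; _≗_; refl; sym; trans; cong; cong₂; subst; subst₂; module ≡-Reasoning)
open import Relation.Nullary using (¬_; Dec; yes; no; does)
open import Relation.Nullary.Decidable using (_×-dec_; dec-true; dec-false; decidable-stable)

bit : Bool → ℕ
bit false = 0
bit true  = 1

bit+2*-injective : ∀ b b′ x y → bit b + 2 * x ≡ bit b′ + 2 * y → b ≡ b′ × x ≡ y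
bit+2*-injective false false x y e = refl , *-cancelˡ-≡ x y 2 e
bit+2*-injective true  true  x y e = refl , *-cancelˡ-≡ x y 2 (suc-injective e)
bit+2*-injective false true  x y e = ⊥-elim (even≢odd x y e)
bit+2*-injective true  false x y e = ⊥-elim (even≢odd y x (sym e))

-- Bijective base-2 numeration (digits 1 and 2), so that no two bit strings of
-- different lengths share a value.
bitsToℕ : List Bool → ℕ
bitsToℕ []      = 0
bitsToℕ (b ∷ l) = suc (bit b + 2 * bitsToℕ l)

bitsToℕ-injective : ∀ l l′ → bitsToℕ l ≡ bitsToℕ l′ → l ≡ l′
bitsToℕ-injective []      []        _ = refl
bitsToℕ-injective (b ∷ l) (b′ ∷ l′) e with bit+2*-injective b b′ _ _ (suc-injective e)
... | refl , e′ = cong (b ∷_) (bitsToℕ-injective l l′ e′)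

2+bitsToℕ≤2^1+length : ∀ l → 2 + bitsToℕ l ≤ 2 ^ suc (length l)
2+bitsToℕ≤2^1+length []      = ≤-refl
2+bitsToℕ≤2^1+length (b ∷ l) = begin
  3 + (bit b + 2 * x)    ≤⟨ +-monoʳ-≤ 3 (+-monoˡ-≤ (2 * x) (bit≤1 b)) ⟩
  3 + (1 + 2 * x)        ≡⟨ regroup x ⟩
  2 * (2 + x)            ≤⟨ *-monoʳ-≤ 2 (2+bitsToℕ≤2^1+length l) ⟩
  2 * 2 ^ suc (length l) ∎
  where
  open ≤-Reasoning
  x = bitsToℕ l
  regroup : ∀ x → 3 + (1 + 2 * x) ≡ 2 * (2 + x)
  regroup = solve-∀
  bit≤1 : ∀ b → bit b ≤ 1
  bit≤1 false = z≤n
  bit≤1 true  = ≤-refl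

encodeCert : ∀ {c} → Cert c → Fin (2 ^ suc c)
encodeCert (l , l≤c) =
  fromℕ< (≤-trans (n≤1+n _) (≤-trans (2+bitsToℕ≤2^1+length l) (^-monoʳ-≤ 2 (s≤s l≤c))))

encodeCert-injective : ∀ {c} (w w′ : Cert c) → encodeCert w ≡ encodeCert w′ → w ≡ w′
encodeCert-injective (l , p) (l′ , p′) e
  with refl ← bitsToℕ-injective l l′ (trans (sym (toℕ-fromℕ< _)) (trans (cong toℕ e) (toℕ-fromℕ< _)))
  = cong (l ,_) (≤-irrelevant p p′)

stateAsCert : ∀ {m} → State m → Cert m
stateAsCert v = toList v , ≤-reflexive (length-toList v)

stateAsCert-injective : ∀ {m} → Injective _≡_ _≡_ (stateAsCert {m})
stateAsCert-injective {m} {v} {v′} e =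
  trans (sym (cast-is-id refl v)) (toList-injective {m = m} {n = m} refl v v′ (cong proj₁ e))

encode : ∀ {c m} → Cert c × State m → Fin (2 ^ suc c * 2 ^ suc m)
encode (w , v) = combine (encodeCert w) (encodeCert (stateAsCert v))

encode-injective : ∀ {c m} → Injective _≡_ _≡_ (encode {c} {m})
encode-injective {c} {m} {w , v} {w′ , v′} e
  with ew , ev ← combine-injective (encodeCert w) _ (encodeCert w′) _ e
  = cong₂ _,_ (encodeCert-injective w w′ ew)
              (stateAsCert-injective (encodeCert-injective (stateAsCert v) (stateAsCert v′) ev))

funToFin-cong : ∀ {m n} {f g : Fin m → Fin n} → f ≗ g → funToFin f ≡ funToFin g
funToFin-cong {zero}  _   = refl
funToFin-cong {suc m} f≗g = cong₂ combine (f≗g Fin.zero) (funToFin-cong (f≗g ∘ Fin.suc))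

finToFun-injective : ∀ {m n} {x y : Fin (m ^ n)} → finToFun x ≗ finToFun y → x ≡ y
finToFun-injective {m} {n} {x} {y} x≗y = begin
  x                             ≡⟨ sym (funToFin-finToFin {n} {m} x) ⟩
  funToFin {n} {m} (finToFun x) ≡⟨ funToFin-cong {n} {m} x≗y ⟩
  funToFin {n} {m} (finToFun y) ≡⟨ funToFin-finToFin {n} {m} y ⟩
  y                             ∎
  where open ≡-Reasoning

_∪_ : ∀ {n} → Graph n → Graph n → Graph n
(E ∪ F) u v = E u v ∨ F u v

module _ {n : ℕ} where

  allPairs : List (Pair n)
  allPairs = cartesianProduct (allFin n) (allFin n)

  CanonicalEdge : Graph n → Pair n → Set
  CanonicalEdge E (u , v) = IsEdge E u v

  canonicalEdge? : (E : Graph n) → Decidable (CanonicalEdge E)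
  canonicalEdge? E (u , v) = (toℕ u <? toℕ v) ×-dec (E u v Bool.≟ true)

  edgeList : Graph n → List (Pair n)
  edgeList E = filter (canonicalEdge? E) allPairs

  edgeList-isStream : (E : Graph n) → IsStream E (edgeList E)
  edgeList-isStream E =
      Unique.filter⁺ (canonicalEdge? E) (Unique.cartesianProduct⁺ (Unique.allFin⁺ n) (Unique.allFin⁺ n))
    , All.tabulate (proj₁ ∘ listed⇒edge)
    , λ u v u<v → proj₂ ∘ listed⇒edge , λ e → edge⇒listed (u<v , e)
    where
    listed⇒edge : ∀ {p} → p ∈ edgeList E → CanonicalEdge E p
    listed⇒edge = proj₂ ∘ ∈-filter⁻ (canonicalEdge? E) {xs = allPairs}
    edge⇒listed : ∀ {u v} → IsEdge E u v → (u , v) ∈ edgeList E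
    edge⇒listed {u} {v} = ∈-filter⁺ (canonicalEdge? E) {xs = allPairs} (∈-cartesianProduct⁺ (∈-allFin u) (∈-allFin v))

  streamed⇒edge : ∀ {E s p} → IsStream E s → p ∈ s → CanonicalEdge E p
  streamed⇒edge {p = u , v} (_ , canonical , edges) p∈s =
    let u<v = All.lookup canonical p∈s in u<v , proj₁ (edges u v u<v) p∈s

  ++-isStream : ∀ {E F s r} → IsStream E s → IsStream F r → (∀ u v → E u v ≡ true → F u v ≡ true → ⊥) →
                IsStream (E ∪ F) (s ++ r)
  ++-isStream {E} {F} {s} {r} s-stream@(s-unique , s-canonical , s-edges) r-stream@(r-unique , r-canonical , r-edges)
              disjoint =
      Unique.++⁺ s-unique r-unique
        (λ (p∈s , p∈r) → disjoint _ _ (proj₂ (streamed⇒edge s-stream p∈s)) (proj₂ (streamed⇒edge r-stream p∈r)))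
    , All.++⁺ s-canonical r-canonical
    , λ u v u<v → listed⇒edge u v u<v , edge⇒listed u v u<v
    where
    listed⇒edge : ∀ u v → toℕ u < toℕ v → (u , v) ∈ s ++ r → E u v ∨ F u v ≡ true
    listed⇒edge u v u<v =
      [ (λ uv∈s → cong (_∨ F u v) (proj₁ (s-edges u v u<v) uv∈s))
      , (λ uv∈r → trans (cong (E u v ∨_) (proj₁ (r-edges u v u<v) uv∈r)) (∨-zeroʳ (E u v)))
      ]′ ∘ ∈-++⁻ s
    edge⇒listed : ∀ u v → toℕ u < toℕ v → E u v ∨ F u v ≡ true → (u , v) ∈ s ++ r
    edge⇒listed u v u<v e with E u v in eᴱ
    ... | true  = ∈-++⁺ˡ (proj₂ (s-edges u v u<v) eᴱ)
    ... | false = ∈-++⁺ʳ s (proj₂ (r-edges u v u<v) e)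

false≢true : false ≢ true
false≢true ()

clique⇒¬colourable : ∀ {n k} (E : Graph n) → (∀ u → E u u ≡ false) →
  (h : Fin (suc k) → Fin n) → (∀ p q → p ≢ q → E (h p) (h q) ≡ true) → ¬ ChromaticAtMost k E
clique⇒¬colourable E irreflexive h clique (colour , proper) = <-irrefl refl (injective⇒≤ colour∘h-injective)
  where
  adjacent⇒colours-differ : ∀ u v → E u v ≡ true → E v u ≡ true → colour u ≢ colour v
  adjacent⇒colours-differ u v uv vu with <-cmp (toℕ u) (toℕ v)
  ... | tri< u<v _ _ = proper u v (u<v , uv)
  ... | tri> _ _ v<u = proper v u (v<u , vu) ∘ sym
  ... | tri≈ _ u≡v _ with refl ← toℕ-injective u≡v = λ _ → false≢true (trans (sym (irreflexive u)) uv)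

  colour∘h-injective : Injective _≡_ _≡_ (colour ∘ h)
  colour∘h-injective {p} {q} same with p Fin.≟ q
  ... | yes p≡q = p≡q
  ... | no p≢q  = ⊥-elim (adjacent⇒colours-differ (h p) (h q) (clique p q p≢q) (clique q p (p≢q ∘ sym)) same)

-- The fooling-set argument

module Fooling {n c m : ℕ} (V : Verifier n c m) (certifies : CertifiesColoring V) (k : ℕ) {X : Set}
               (G : X → X → Graph n) (first second : X → List (Pair n))
               (streams : ∀ x y → IsStream (G x y) (first x ++ second y))
               (diagonal-colourable : ∀ x → ChromaticAtMost k (G x x)) where

  open Verifier V

  certificate : X → Cert c
  certificate x = proj₁ (proj₁ (certifies k (G x x)) (diagonal-colourable x))

  midpoint : X → Cert c × State m
  midpoint x = certificate x , foldl (step (certificate x)) (init k (certificate x)) (first x)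

  resume : Cert c × State m → List (Pair n) → Bool
  resume (w , σ) s = accept w (foldl (step w) σ s)

  run-via-midpoint : ∀ x y → run V k (certificate x) (first x ++ second y) ≡ resume (midpoint x) (second y)
  run-via-midpoint x y = cong (accept w) (foldl-++ (step w) (init k w) (first x) (second y))
    where w = certificate x

  midpoint-collision : ∀ x y → midpoint x ≡ midpoint y → ¬ ¬ ChromaticAtMost k (G x y)
  midpoint-collision x y same ¬colourable = false≢true (begin
    false                                              ≡⟨ sym rejected ⟩
    run V k (certificate x) (first x ++ second y)      ≡⟨ run-via-midpoint x y ⟩
    resume (midpoint x) (second y)                     ≡⟨ cong (λ z → resume z (second y)) same ⟩
    resume (midpoint y) (second y)                     ≡⟨ sym (run-via-midpoint y y) ⟩
    run V k (certificate y) (first y ++ second y)      ≡⟨ accepted ⟩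
    true                                               ∎)
    where
    open ≡-Reasoning
    rejected = proj₂ (certifies k (G x y)) ¬colourable (certificate x) _ (streams x y)
    accepted = proj₂ (proj₁ (certifies k (G y y)) (diagonal-colourable y)) _ (streams y y)

-- The graph family

differ : ∀ {k} → Fin k → Fin k → Bool
differ i j = not (does (i Fin.≟ j))

differ-refl : ∀ {k} (i : Fin k) → differ i i ≡ false
differ-refl i = cong not (dec-true (i Fin.≟ i) refl)

≢⇒differ : ∀ {k} {i j : Fin k} → i ≢ j → differ i j ≡ true
≢⇒differ {i = i} {j} i≢j = cong not (dec-false (i Fin.≟ j) i≢j)

differ⇒≢ : ∀ {k} {i j : Fin k} → differ i j ≡ true → i ≢ j
differ⇒≢ {i = i} d refl = false≢true (trans (sym (differ-refl i)) d)

module Construction (k t : ℕ) where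

  data Role : Set where
    anchor₁ anchor₂ : Fin k → Role
    var             : Fin t → Role

  label : (Fin t → Fin k) → Role → Fin k
  label f (anchor₁ i) = i
  label f (anchor₂ i) = i
  label f (var j)     = f j

  isLatePair : Role → Role → Bool
  isLatePair (anchor₂ _) (var _)     = true
  isLatePair (var _)     (anchor₂ _) = true
  isLatePair _           _           = false

  earlyEdge lateEdge : (Fin t → Fin k) → Role → Role → Bool
  earlyEdge f a b = not (isLatePair a b) ∧ differ (label f a) (label f b)
  lateEdge  g a b = isLatePair a b ∧ differ (label g a) (label g b)

  adjacent : (f g : Fin t → Fin k) → Role → Role → Bool
  adjacent f g a b = earlyEdge f a b ∨ lateEdge g a b

  early-late-disjoint : ∀ f g a b → earlyEdge f a b ≡ true → lateEdge g a b ≡ true → ⊥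
  early-late-disjoint f g a b early late with isLatePair a b
  early-late-disjoint f g a b () late | true
  early-late-disjoint f g a b early () | false

  adjacent-irreflexive : ∀ f g a → adjacent f g a a ≡ false
  adjacent-irreflexive f g a with isLatePair a a
  ... | true  = differ-refl (label g a)
  ... | false = trans (∨-identityʳ _) (differ-refl (label f a))

  adjacent⇒labels-differ : ∀ f a b → adjacent f f a b ≡ true → label f a ≢ label f b
  adjacent⇒labels-differ f a b adj with isLatePair a b
  ... | true  = differ⇒≢ adj
  ... | false = differ⇒≢ (trans (sym (∨-identityʳ _)) adj)

  adjacent-early : ∀ f g a b → isLatePair a b ≡ false → label f a ≢ label f b → adjacent f g a b ≡ true
  adjacent-early f g a b early ne rewrite early | ≢⇒differ ne = refl

  adjacent-late : ∀ f g a b → isLatePair a b ≡ true → label g a ≢ label g b → adjacent f g a b ≡ true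
  adjacent-late f g a b late ne rewrite late | ≢⇒differ ne = refl

  role : Fin (k + k + t) → Role
  role u = [ [ anchor₁ , anchor₂ ]′ ∘ splitAt k , var ]′ (splitAt (k + k) u)

  vertex : Role → Fin (k + k + t)
  vertex (anchor₁ i) = (i ↑ˡ k) ↑ˡ t
  vertex (anchor₂ i) = (k ↑ʳ i) ↑ˡ t
  vertex (var j)     = (k + k) ↑ʳ j

  role-vertex : ∀ a → role (vertex a) ≡ a
  role-vertex (anchor₁ i) rewrite splitAt-↑ˡ (k + k) (i ↑ˡ k) t | splitAt-↑ˡ k i k = refl
  role-vertex (anchor₂ i) rewrite splitAt-↑ˡ (k + k) (k ↑ʳ i) t | splitAt-↑ʳ k k i = refl
  role-vertex (var j)     rewrite splitAt-↑ʳ (k + k) t j = refl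

  onVertices : (Role → Role → Bool) → Graph (k + k + t)
  onVertices R u v = R (role u) (role v)

  G : (f g : Fin t → Fin k) → Graph (k + k + t)
  G f g = onVertices (adjacent f g)

  G-isStream : ∀ f g → IsStream (G f g) (edgeList (onVertices (earlyEdge f)) ++ edgeList (onVertices (lateEdge g)))
  G-isStream f g = ++-isStream (edgeList-isStream _) (edgeList-isStream _)
                               (λ u v → early-late-disjoint f g (role u) (role v))

  G-colourable : ∀ f → ChromaticAtMost k (G f f)
  G-colourable f = label f ∘ role , λ u v (_ , adj) → adjacent⇒labels-differ f (role u) (role v) adj

  module _ {f g : Fin t → Fin k} {j : Fin t} (f≢g : f j ≢ g j) where

    anchorFor : (l : Fin k) → Dec (l ≡ f j) → Role
    anchorFor l (yes _) = anchor₂ l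
    anchorFor l (no _)  = anchor₁ l

    member : Fin (suc k) → Role
    member Fin.zero    = var j
    member (Fin.suc l) = anchorFor l (l Fin.≟ f j)

    var-anchor : ∀ l d → adjacent f g (var j) (anchorFor l d) ≡ true
    var-anchor l (yes l≡fj) = adjacent-late f g (var j) (anchor₂ l) refl (λ gj≡l → f≢g (trans (sym l≡fj) (sym gj≡l)))
    var-anchor l (no l≢fj)  = adjacent-early f g (var j) (anchor₁ l) refl (l≢fj ∘ sym)

    anchor-var : ∀ l d → adjacent f g (anchorFor l d) (var j) ≡ true
    anchor-var l (yes l≡fj) = adjacent-late f g (anchor₂ l) (var j) refl (λ l≡gj → f≢g (trans (sym l≡fj) l≡gj))
    anchor-var l (no l≢fj)  = adjacent-early f g (anchor₁ l) (var j) refl l≢fj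

    anchor-anchor : ∀ {l l′} d d′ → l ≢ l′ → adjacent f g (anchorFor l d) (anchorFor l′ d′) ≡ true
    anchor-anchor {l} {l′} (yes _) (yes _) = adjacent-early f g (anchor₂ l) (anchor₂ l′) refl
    anchor-anchor {l} {l′} (yes _) (no _)  = adjacent-early f g (anchor₂ l) (anchor₁ l′) refl
    anchor-anchor {l} {l′} (no _)  (yes _) = adjacent-early f g (anchor₁ l) (anchor₂ l′) refl
    anchor-anchor {l} {l′} (no _)  (no _)  = adjacent-early f g (anchor₁ l) (anchor₁ l′) refl

    member-clique : ∀ p q → p ≢ q → adjacent f g (member p) (member q) ≡ true
    member-clique Fin.zero    Fin.zero     p≢q = ⊥-elim (p≢q refl)
    member-clique Fin.zero    (Fin.suc l)  _   = var-anchor l (l Fin.≟ f j)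
    member-clique (Fin.suc l) Fin.zero     _   = anchor-var l (l Fin.≟ f j)
    member-clique (Fin.suc l) (Fin.suc l′) p≢q = anchor-anchor (l Fin.≟ f j) (l′ Fin.≟ f j) (p≢q ∘ cong Fin.suc)

    G-¬colourable : ¬ ChromaticAtMost k (G f g)
    G-¬colourable = clique⇒¬colourable (G f g) (λ u → adjacent-irreflexive f g (role u)) (vertex ∘ member)
      (λ p q p≢q → subst₂ (λ a b → adjacent f g a b ≡ true)
                          (sym (role-vertex (member p))) (sym (role-vertex (member q))) (member-clique p q p≢q))

  ¬¬colourable⇒≗ : ∀ {f g} → ¬ ¬ ChromaticAtMost k (G f g) → f ≗ g
  ¬¬colourable⇒≗ {f} {g} ¬¬colourable j = decidable-stable (f j Fin.≟ g j) (¬¬colourable ∘ G-¬colourable)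

  k^t≤2^[1+c]*2^[1+m] : ∀ {n c m} → k + k + t ≡ n → (V : Verifier n c m) → CertifiesColoring V →
               k ^ t ≤ 2 ^ suc c * 2 ^ suc m
  k^t≤2^[1+c]*2^[1+m] refl V certifies = injective⇒≤ {f = encode ∘ midpoint ∘ finToFun} (λ same →
      finToFun-injective (¬¬colourable⇒≗ (midpoint-collision _ _ (encode-injective same))))
    where
    open Fooling V certifies k G (edgeList ∘ onVertices ∘ earlyEdge) (edgeList ∘ onVertices ∘ lateEdge)
                 G-isStream G-colourable

2*⌊n/2⌋≤n : ∀ n → 2 * ⌊ n /2⌋ ≤ n
2*⌊n/2⌋≤n n = begin
  2 * ⌊ n /2⌋           ≡⟨ cong (⌊ n /2⌋ +_) (+-identityʳ ⌊ n /2⌋) ⟩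
  ⌊ n /2⌋ + ⌊ n /2⌋     ≤⟨ +-monoʳ-≤ ⌊ n /2⌋ (⌊n/2⌋≤⌈n/2⌉ n) ⟩
  ⌊ n /2⌋ + ⌈ n /2⌉     ≡⟨ ⌊n/2⌋+⌈n/2⌉≡n n ⟩
  n                     ∎
  where open ≤-Reasoning

L≤⌊log₂n⌋⇒2^L≤n : ∀ {L n} → 1 ≤ n → L ≤ ⌊log₂ n ⌋ → 2 ^ L ≤ n
L≤⌊log₂n⌋⇒2^L≤n {zero}  1≤n _ = 1≤n
L≤⌊log₂n⌋⇒2^L≤n {suc L} {suc (suc n)} _ L<log = begin
  2 * 2 ^ L             ≤⟨ *-monoʳ-≤ 2 (L≤⌊log₂n⌋⇒2^L≤n (s≤s z≤n) L≤log-half) ⟩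
  2 * ⌊ 2 + n /2⌋       ≤⟨ 2*⌊n/2⌋≤n (2 + n) ⟩
  2 + n                 ∎
  where
  open ≤-Reasoning
  L≤log-half : L ≤ ⌊log₂ ⌊ 2 + n /2⌋ ⌋
  L≤log-half = subst (L ≤_) (sym (⌊log₂⌊n/2⌋⌋≡⌊log₂n⌋∸1 (2 + n))) (∸-monoˡ-≤ 1 L<log)

2^-cancel-≤ : ∀ {a b} → 2 ^ a ≤ 2 ^ b → a ≤ b
2^-cancel-≤ 2^a≤2^b = ≮⇒≥ (λ b<a → <⇒≱ (^-monoʳ-< 2 (s≤s (s≤s z≤n)) b<a) 2^a≤2^b)

n*[2+s]≤8*C : ∀ {n s t C} → 2 ≤ s → 2 ≤ t → n ≤ t + t → s * t ≤ 2 + C → n * (2 + s) ≤ 8 * C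
n*[2+s]≤8*C {n} {s} {t} {C} 2≤s 2≤t n≤t+t st≤2+C = begin
  n * (2 + s)           ≤⟨ *-mono-≤ n≤t+t (+-monoˡ-≤ s 2≤s) ⟩
  (t + t) * (s + s)     ≡⟨ four-times s t ⟩
  4 * (s * t)           ≤⟨ *-monoʳ-≤ 4 st≤2+C ⟩
  4 * (2 + C)           ≤⟨ *-monoʳ-≤ 4 (+-monoˡ-≤ C 2≤C) ⟩
  4 * (C + C)           ≡⟨ double C ⟩
  8 * C                 ∎
  where
  open ≤-Reasoning
  four-times : ∀ s t → (t + t) * (s + s) ≡ 4 * (s * t)
  four-times = solve-∀
  double : ∀ C → 4 * (C + C) ≡ 8 * C
  double = solve-∀
  2≤C : 2 ≤ C
  2≤C = +-cancelˡ-≤ 2 2 C (≤-trans (*-mono-≤ 2≤s 2≤t) st≤2+C)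

m+m≤n⇒m≤n∸m : ∀ {m n} → m + m ≤ n → m ≤ n ∸ m
m+m≤n⇒m≤n∸m {m} {n} m+m≤n = +-cancelˡ-≤ m m (n ∸ m)
  (subst (m + m ≤_) (sym (m+[n∸m]≡n (≤-trans (m≤m+n m m) m+m≤n))) m+m≤n)

m+m≤n⇒n≤[n∸m]+[n∸m] : ∀ {m n} → m + m ≤ n → n ≤ (n ∸ m) + (n ∸ m)
m+m≤n⇒n≤[n∸m]+[n∸m] {m} {n} m+m≤n =
  subst (_≤ (n ∸ m) + (n ∸ m)) (m+[n∸m]≡n (≤-trans (m≤m+n m m) m+m≤n)) (+-monoˡ-≤ (n ∸ m) (m+m≤n⇒m≤n∸m m+m≤n))

s*t≤2+c+m : ∀ {n c m} s t → 2 ^ s + 2 ^ s + t ≡ n → (V : Verifier n c m) → CertifiesColoring V →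
            s * t ≤ 2 + (c + m)
s*t≤2+c+m {c = c} {m} s t vertices V certifies = 2^-cancel-≤ (begin
  2 ^ (s * t)             ≡⟨ sym (^-*-assoc 2 s t) ⟩
  (2 ^ s) ^ t             ≤⟨ Construction.k^t≤2^[1+c]*2^[1+m] (2 ^ s) t vertices V certifies ⟩
  2 ^ suc c * 2 ^ suc m   ≡⟨ sym (^-distribˡ-+-* 2 (suc c) (suc m)) ⟩
  2 ^ (suc c + suc m)     ≡⟨ cong (λ x → 2 ^ suc x) (+-suc c m) ⟩
  2 ^ (2 + (c + m))       ∎)
  where open ≤-Reasoning

n*⌊log₂n⌋≤8*[c+m] : ∀ {n c m} (V : Verifier n c m) → CertifiesColoring V → 16 ≤ n → n * ⌊log₂ n ⌋ ≤ 8 * (c + m)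
n*⌊log₂n⌋≤8*[c+m] {n} {c} {m} V certifies 16≤n =
  subst (λ L → n * L ≤ 8 * (c + m)) (sym L≡2+s)
        (n*[2+s]≤8*C 2≤s 2≤t (m+m≤n⇒n≤[n∸m]+[n∸m] {k + k} 4k≤n) (s*t≤2+c+m s t vertices V certifies))
  where
  open ≤-Reasoning
  L = ⌊log₂ n ⌋
  4≤L : 4 ≤ L
  4≤L = subst (_≤ L) (⌊log₂[2^n]⌋≡n 4) (⌊log₂⌋-mono-≤ 16≤n)
  s = L ∸ 2
  L≡2+s : L ≡ 2 + s
  L≡2+s = sym (m+[n∸m]≡n (≤-trans (s≤s (s≤s z≤n)) 4≤L))
  2≤s : 2 ≤ s
  2≤s = ∸-monoˡ-≤ 2 4≤L
  k = 2 ^ s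
  quadruple : ∀ x → x + x + (x + x) ≡ 2 * (2 * x)
  quadruple = solve-∀
  4k≤n : k + k + (k + k) ≤ n
  4k≤n = begin
    k + k + (k + k) ≡⟨ quadruple k ⟩
    2 ^ (2 + s)     ≡⟨ cong (2 ^_) (sym L≡2+s) ⟩
    2 ^ L           ≤⟨ L≤⌊log₂n⌋⇒2^L≤n (≤-trans (s≤s z≤n) 16≤n) ≤-refl ⟩
    n               ∎
  t = n ∸ (k + k)
  vertices : k + k + t ≡ n
  vertices = m+[n∸m]≡n (≤-trans (m≤m+n (k + k) (k + k)) 4k≤n)
  2≤t : 2 ≤ t
  2≤t = ≤-trans (+-mono-≤ (m^n>0 2 s) (m^n>0 2 s)) (m+m≤n⇒m≤n∸m {k + k} 4k≤n)

theorem14 : (c m : ℕ → ℕ) (V : (n : ℕ) → Verifier n (c n) (m n)) →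
    ((n : ℕ) → CertifiesColoring (V n)) →
    Σ ℕ λ a → Σ ℕ λ N → ∀ n → N ≤ n → n * ⌊log₂ n ⌋ ≤ suc a * (c n + m n)
theorem14 c m V certifies = 7 , 16 , λ n → n*⌊log₂n⌋≤8*[c+m] (V n) (certifies n)
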